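{- Let $\varphi$ be an instance of \textsc{$q$-CSP-6} with variables $x_1,\dots,x_n$ and constraints $c_0,\dots,c_{m-1}$, and let $G$ and $k$ be constructed from $\varphi$ as described in the context. If $\varphi$ is satisfiable, then $G$ has an upper dominating set of size at least $k$.
   Context: \textsc{$q$-CSP-6}: variables $x_1,\dots,x_n$ take values in $\{0,1,2,3,4,5\}$; each constraint $c_j$ ($0\le j\le m-1$) involves exactly $q$ variables and is given as a list of $C_j$ acceptable assignments $\sigma_1,\dots,\sigma_{C_j}$ of values to its $q$ variables; $\varphi$ is satisfiable if some assignment of all variables restricts to an acceptable assignment of every constraint. Construction: set $A=4q+2$, $F=(2n+1)(4n+1)$, $k=Fm(2n+A)+2n$. (1) For each $i\in\{1,\dots,n\}$ build a path $P_i$ on vertices $u_{i,j}$, $j\in\{ -3,\dots,4Fm+2\}$, with edges $u_{i,j}u_{i,j+1}$. (2) For each $j\in\{0,\dots,Fm-1\}$, with $j'=j\bmod m$, build a gadget $H_j$: a clique $K_j$ on $AC_{j'}$ vertices partitioned into $C_{j'}$ sets $K_j^1,\dots,K_j^{C_{j'}}$ of size $A$ ($K_j^l$ corresponds to $\sigma_l$ in the list of $c_{j'}$); a clique $L_j$ on $AC_{j'}$ vertices partitioned into sets $L_j^1,\dots,L_j^{C_{j'}}$ of size $A$. For each variable $x_i$ involved in $c_{j'}$ and each $l$, if $\sigma_l$ gives $x_i$ value $v$, connect both vertices of the pair $p_v$ to all $A$ vertices of $K_j^l$, where $p_0=\{u_{i,4j+2},u_{i,4j+3}\}$, $p_1=\{u_{i,4j+3},u_{i,4j}\}$,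 $p_2=\{u_{i,4j},u_{i,4j+1}\}$, $p_3=\{u_{i,4j+1},u_{i,4j+2}\}$, $p_4=\{u_{i,4j+1},u_{i,4j+3}\}$, $p_5=\{u_{i,4j},u_{i,4j+2}\}$. For each $l$, add a perfect matching between $K_j^l$ and $L_j^l$, and all edges between $K_j^l$ and $L_j^{l'}$ for every $l'\ne l$. Add a vertex $w_j$ adjacent to all vertices of $L_j$. A set $D$ of vertices is dominating if every vertex is in $D$ or adjacent to a vertex of $D$; an upper dominating set is an inclusion-minimal dominating set. -}

module Defs where

open import Data.Nat using (ℕ; _+_; _*_; _≤_)
open import Data.Fin using (Fin; toℕ; inject₁; suc; zero; remainder)
open import Data.Product using (Σ; _×_; _,_; proj₁; proj₂; ∃)
open import Data.Sum using (_⊎_)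
open import Data.List using (List)
open import Data.List.Membership.Propositional using (_∈_)
open import Relation.Binary.PropositionalEquality using (_≡_; _≢_)
open import Relation.Nullary using (¬_)
open import Function.Definitions using (Injective)

module _ {V : Set} (Adj : V → V → Set) where

  IsDominating : List V → Set
  IsDominating D = ∀ v → v ∈ D ⊎ Σ V (λ x → x ∈ D × Adj x v)

  IsUpperDominating : List V → Set
  IsUpperDominating D =
    IsDominating D ×
    (∀ (D' : List V) → (∀ x → x ∈ D' → x ∈ D) → IsDominating D' →
       ∀ x → x ∈ D → x ∈ D')

-- q-CSP-6 instances.  Variables x_1..x_n are indexed by Fin n,
-- values {0,..,5} by Fin 6, constraints c_0..c_{m-1} by Fin m.

record CSP6 (q : ℕ) : Set where
  field
    n : ℕ
    m : ℕ
    scope : Fin m → Fin q → Fin n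
    scope-inj : ∀ j → Injective _≡_ _≡_ (scope j)
    -- number C_j of acceptable assignments of constraint j
    C : Fin m → ℕ
    -- σ j l p : value given to the p-th variable of c_j by σ_l
    σ : (j : Fin m) → Fin (C j) → Fin q → Fin 6

Satisfiable : ∀ {q} → CSP6 q → Set
Satisfiable {q} φ =
  Σ (Fin n → Fin 6) λ x →
    ∀ (j : Fin m) → Σ (Fin (C j)) λ l → ∀ (p : Fin q) → σ j l p ≡ x (scope j p)
  where open CSP6 φ

-- offsets (relative to 4j) of the pair p_v
pairOff : Fin 6 → ℕ × ℕ
pairOff zero = 2 , 3
pairOff (suc zero) = 3 , 0
pairOff (suc (suc zero)) = 0 , 1
pairOff (suc (suc (suc zero))) = 1 , 2
pairOff (suc (suc (suc (suc zero)))) = 1 , 3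
pairOff (suc (suc (suc (suc (suc zero))))) = 0 , 2

module Construction {q : ℕ} (φ : CSP6 q) where
  open CSP6 φ public

  A : ℕ
  A = 4 * q + 2

  F : ℕ
  F = (2 * n + 1) * (4 * n + 1)

  k : ℕ
  k = F * m * (2 * n + A) + 2 * n

  -- gadget H_j exists for j ∈ {0,..,Fm-1}
  -- j' = j mod m
  red : Fin (F * m) → Fin m
  red j = remainder {F} m j

  -- path vertex  u i t  stands for  u_{i, t-3},  t ∈ {0,..,4Fm+5}
  -- (so path indices j ∈ {-3,..,4Fm+2});
  -- kv j l a : a-th vertex of K_j^l ;  lv j l a : a-th vertex of L_j^l
  data Vertex : Set where
    u  : Fin n → Fin (6 + 4 * (F * m)) → Vertex
    kv : (j : Fin (F * m)) → Fin (C (red j)) → Fin A → Vertex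
    lv : (j : Fin (F * m)) → Fin (C (red j)) → Fin A → Vertex
    w  : Fin (F * m) → Vertex

  InPair : Fin 6 → Fin (6 + 4 * (F * m)) → Fin (F * m) → Set
  InPair v t j =
    toℕ t ≡ 4 * toℕ j + proj₁ (pairOff v) + 3 ⊎
    toℕ t ≡ 4 * toℕ j + proj₂ (pairOff v) + 3

  data Edge : Vertex → Vertex → Set where
    path  : ∀ i (t : Fin (5 + 4 * (F * m))) → Edge (u i (inject₁ t)) (u i (suc t))
    kk    : ∀ j l a l' a' → ¬ (l ≡ l' × a ≡ a') → Edge (kv j l a) (kv j l' a')
    ll    : ∀ j l a l' a' → ¬ (l ≡ l' × a ≡ a') → Edge (lv j l a) (lv j l' a')
    ku    : ∀ j l a (p : Fin q) t → InPair (σ (red j) l p) t j →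
            Edge (kv j l a) (u (scope (red j) p) t)
    match : ∀ j l a → Edge (kv j l a) (lv j l a)
    cross : ∀ j l a l' a' → l ≢ l' → Edge (kv j l a) (lv j l' a')
    lw    : ∀ j l a → Edge (lv j l a) (w j)

  Adj : Vertex → Vertex → Set
  Adj x y = Edge x y ⊎ Edge y x

module Submission where

open import Data.Bool using (Bool; true; false; if_then_else_)
open import Data.Empty using (⊥; ⊥-elim)
open import Data.Fin using (Fin; toℕ; inject₁; lower₁; fromℕ<) renaming (zero to fzero; suc to fsuc)
open import Data.Fin.Patterns using (0F; 1F; 2F; 3F; 4F; 5F)
import Data.Fin.Properties as Fin
open import Data.Fin.Properties using (all?; toℕ-injective; toℕ-inject₁; inject₁-lower₁)
open import Data.List using (List; length; filter; tabulate; concat; map; allFin; _++_)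
open import Data.List.Properties using (length-++; length-map; length-tabulate)
open import Data.List.Membership.Propositional using (_∈_)
open import Data.List.Membership.Propositional.Properties
  using (∈-concat⁺′; ∈-concat⁻′; ∈-tabulate⁺; ∈-tabulate⁻; ∈-++⁺ˡ; ∈-++⁺ʳ; ∈-++⁻; ∈-map⁺; ∈-map⁻; ∈-filter⁺; ∈-filter⁻; ∈-allFin)
import Data.List.Relation.Unary.All.Properties as All
import Data.List.Relation.Unary.AllPairs.Properties as AllPairs
open import Data.List.Relation.Unary.Unique.Propositional using (Unique)
open import Data.List.Relation.Unary.Unique.Propositional.Properties using (concat⁺; ++⁺; map⁺; filter⁺; allFin⁺)
open import Data.Nat using (ℕ; zero; suc; _+_; _*_; _≤_; _<_; _≤?_; _<?_; z≤n; s≤s)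
import Data.Nat.Properties as ℕ
open import Data.Nat.Tactic.RingSolver using (solve-∀)
open import Data.Product using (Σ; _×_; _,_; proj₁; proj₂)
open import Data.Sum using (_⊎_; inj₁; inj₂)
open import Data.Vec using (Vec; []; _∷_; lookup)
open import Function using (id; _∘_; case_of_)
open import Relation.Binary.Definitions using (DecidableEquality)
open import Relation.Binary.PropositionalEquality
  using (_≡_; _≢_; refl; sym; trans; cong; subst; module ≡-Reasoning)
open import Relation.Nullary using (Dec; yes; no; does; ¬?; _×-dec_; _⊎-dec_; _→-dec_)
open import Relation.Nullary.Decidable using (from-yes; dec-true)
open import Defs

-- Fix a satisfying assignment x and, for every constraint, an acceptable assignment σ_l
-- agreeing with x. Put L_j^l into D for every gadget H_j, and on each path P_i the two of the
-- four vertices next to each gadget that are not in the pair p_{x_i}, plus fixed patterns at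
-- both ends of the path. This set dominates G, and each of its vertices has a private
-- neighbour: itself or a path neighbour on P_i, and for a vertex of L_j^l its matching partner
-- in K_j^l, which sees no chosen path vertex because it is attached exactly to the pairs
-- p_{x_i}. A dominating set in which every vertex has a private neighbour is inclusion-minimal,
-- and it has at least 2 + 2Fm vertices on every path and A in every gadget, i.e. at least k.

module _ {V : Set} (Adj : V → V → Set) where

  PrivateNeighbour : List V → V → V → Set
  PrivateNeighbour D x y = ∀ z → z ∈ D → z ≡ y ⊎ Adj z y → z ≡ x

  private-neighbours⇒upper-dominating : ∀ {D} → IsDominating Adj D →
    (∀ x → x ∈ D → Σ V (PrivateNeighbour D x)) → IsUpperDominating Adj D
  private-neighbours⇒upper-dominating {D} dom private-neighbour = dom , minimal
    where
    minimal : ∀ D' → (∀ x → x ∈ D' → x ∈ D) → IsDominating Adj D' → ∀ x → x ∈ D → x ∈ D'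
    minimal D' D'⊆D dom' x x∈D with private-neighbour x x∈D
    ... | y , private-y with dom' y
    ...   | inj₁ y∈D' = subst (_∈ D') (private-y y (D'⊆D y y∈D') (inj₁ refl)) y∈D'
    ...   | inj₂ (z , z∈D' , z~y) = subst (_∈ D') (private-y z (D'⊆D z z∈D') (inj₂ z~y)) z∈D'

module _ {B : Set} where

  ⋃ : ∀ {N} → (Fin N → List B) → List B
  ⋃ g = concat (tabulate g)

  ∈-⋃⁺ : ∀ {N} (g : Fin N → List B) i {v} → v ∈ g i → v ∈ ⋃ g
  ∈-⋃⁺ g i v∈ = ∈-concat⁺′ v∈ (∈-tabulate⁺ i)

  ∈-⋃⁻ : ∀ {N} (g : Fin N → List B) {v} → v ∈ ⋃ g → Σ (Fin N) λ i → v ∈ g i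
  ∈-⋃⁻ g v∈ with ∈-concat⁻′ (tabulate g) v∈
  ... | _ , v∈xs , xs∈ with ∈-tabulate⁻ xs∈
  ...   | i , refl = i , v∈xs

  ⋃-unique : ∀ {N} (g : Fin N → List B) → (∀ i → Unique (g i)) →
    (∀ {i j v} → v ∈ g i → v ∈ g j → i ≡ j) → Unique (⋃ g)
  ⋃-unique g unique disjoint =
    concat⁺ (All.tabulate⁺ unique) (AllPairs.tabulate⁺ λ i≢j (p , q) → i≢j (disjoint p q))

  length-⋃ : ∀ {N} (g : Fin N → List B) {c} → (∀ i → c ≤ length (g i)) → N * c ≤ length (⋃ g)
  length-⋃ {zero}  g c≤ = z≤n
  length-⋃ {suc N} g c≤ = subst (_ ≤_) (sym (length-++ (g fzero)))
    (ℕ.+-mono-≤ (c≤ fzero) (length-⋃ (g ∘ fsuc) (c≤ ∘ fsuc)))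

data Cell : Set where
  chosen skipped outside : Cell

_≟_ : DecidableEquality Cell
chosen  ≟ chosen  = yes refl
chosen  ≟ skipped = no λ ()
chosen  ≟ outside = no λ ()
skipped ≟ chosen  = no λ ()
skipped ≟ skipped = yes refl
skipped ≟ outside = no λ ()
outside ≟ chosen  = no λ ()
outside ≟ skipped = no λ ()
outside ≟ outside = yes refl

chosen≢skipped : chosen ≢ skipped
chosen≢skipped ()

chosen≢outside : ∀ {c} → c ≡ chosen → c ≢ outside
chosen≢outside refl ()

skipped≢outside : ∀ {c} → c ≡ skipped → c ≢ outside
skipped≢outside refl ()

inside-unskipped⇒chosen : ∀ {c} → c ≢ outside → c ≢ skipped → c ≡ chosen
inside-unskipped⇒chosen {chosen}  _ _ = refl
inside-unskipped⇒chosen {skipped} _ h = ⊥-elim (h refl)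
inside-unskipped⇒chosen {outside} h _ = ⊥-elim (h refl)

mark : Bool → Cell
mark true  = chosen
mark false = skipped

-- a b c d e are five consecutive cells of a path and the conditions concern c; an outside c
-- needs nothing.
Dominated : Cell → Cell → Cell → Set
Dominated b c d = c ≢ skipped ⊎ b ≡ chosen ⊎ d ≡ chosen

-- The private neighbour of c is c itself, b, or d respectively.
HasPrivateNeighbour : Cell → Cell → Cell → Cell → Cell → Set
HasPrivateNeighbour a b c d e = c ≡ chosen →
  (b ≢ chosen × d ≢ chosen) ⊎ (b ≡ skipped × a ≢ chosen) ⊎ (d ≡ skipped × e ≢ chosen)

Window : (ℕ → Cell) → ℕ → Set
Window g p = Dominated (g (1 + p)) (g (2 + p)) (g (3 + p))
           × HasPrivateNeighbour (g p) (g (1 + p)) (g (2 + p)) (g (3 + p)) (g (4 + p))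

window? : ∀ g p → Dec (Window g p)
window? g p =
  (¬? (g (2 + p) ≟ skipped) ⊎-dec g (1 + p) ≟ chosen ⊎-dec g (3 + p) ≟ chosen) ×-dec
  (g (2 + p) ≟ chosen →-dec
    ((¬? (g (1 + p) ≟ chosen) ×-dec ¬? (g (3 + p) ≟ chosen)) ⊎-dec
     (g (1 + p) ≟ skipped ×-dec ¬? (g p ≟ chosen)) ⊎-dec
     (g (3 + p) ≟ skipped ×-dec ¬? (g (4 + p) ≟ chosen))))

data Step {L : ℕ} : Fin (suc L) → Fin (suc L) → Set where
  step : (t : Fin L) → Step (inject₁ t) (fsuc t)

step-toℕ : ∀ {L} {s t : Fin (suc L)} → Step s t → toℕ t ≡ suc (toℕ s)
step-toℕ (step t) = cong suc (sym (toℕ-inject₁ t))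

-- The path on Fin (suc L) whose vertex t carries the cell g (2 + toℕ t).
module PathDomination {L : ℕ} (g : ℕ → Cell)
  (window : ∀ p → Window g p)
  (before-start : g 1 ≡ outside)
  (real : ∀ k → k < suc L → g (2 + k) ≢ outside)
  (beyond-end : ∀ k → suc L ≤ k → g (2 + k) ≡ outside) where

  Chosen : Fin (suc L) → Set
  Chosen t = g (2 + toℕ t) ≡ chosen

  left-cell : ∀ {s t : Fin (suc L)} → Step s t → g (1 + toℕ t) ≡ g (2 + toℕ s)
  left-cell s→t = cong (λ k → g (1 + k)) (step-toℕ s→t)

  right-cell : ∀ {s t : Fin (suc L)} → Step t s → g (3 + toℕ t) ≡ g (2 + toℕ s)
  right-cell t→s = cong (λ k → g (2 + k)) (sym (step-toℕ t→s))

  predecessor : ∀ t → g (1 + toℕ t) ≢ outside → Σ (Fin (suc L)) λ s → Step s t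
  predecessor fzero    h = ⊥-elim (h before-start)
  predecessor (fsuc t) _ = inject₁ t , step t

  successor : ∀ t → g (3 + toℕ t) ≢ outside → Σ (Fin (suc L)) λ s → Step t s
  successor t h = fsuc t₀ , subst (λ a → Step a (fsuc t₀)) (inject₁-lower₁ t L≢t) (step t₀)
    where
    L≢t : L ≢ toℕ t
    L≢t e = h (subst (λ k → g (3 + k) ≡ outside) e (beyond-end (suc L) ℕ.≤-refl))
    t₀ = lower₁ t L≢t

  dominated : ∀ t → Chosen t ⊎ Σ (Fin (suc L)) λ s → Chosen s × (Step s t ⊎ Step t s)
  dominated t with proj₁ (window (toℕ t))
  ... | inj₁ c≢skipped = inj₁ (inside-unskipped⇒chosen (real (toℕ t) (Fin.toℕ<n t)) c≢skipped)
  ... | inj₂ (inj₁ b≡chosen) with predecessor t (chosen≢outside b≡chosen)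
  ...   | s , s→t = inj₂ (s , trans (sym (left-cell s→t)) b≡chosen , inj₁ s→t)
  dominated t | inj₂ (inj₂ d≡chosen) with successor t (chosen≢outside d≡chosen)
  ...   | s , t→s = inj₂ (s , trans (sym (right-cell t→s)) d≡chosen , inj₂ t→s)

  PathPrivate : Fin (suc L) → Fin (suc L) → Set
  PathPrivate t y = ∀ t' → Chosen t' → t' ≡ y ⊎ Step t' y ⊎ Step y t' → t' ≡ t

  private-neighbour : ∀ t → Chosen t → Σ (Fin (suc L)) (PathPrivate t)
  private-neighbour t c with proj₂ (window (toℕ t)) c
  ... | inj₁ (b≢chosen , d≢chosen) = t , λ where
        t' _  (inj₁ t'≡t)        → t'≡t
        t' c' (inj₂ (inj₁ t'→t)) → ⊥-elim (b≢chosen (trans (left-cell t'→t) c'))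
        t' c' (inj₂ (inj₂ t→t')) → ⊥-elim (d≢chosen (trans (right-cell t→t') c'))
  ... | inj₂ (inj₁ (b≡skipped , a≢chosen)) with predecessor t (skipped≢outside b≡skipped)
  ...   | y , y→t = y , λ where
        t' c' (inj₁ refl) →
          ⊥-elim (chosen≢skipped (trans (sym c') (trans (sym (left-cell y→t)) b≡skipped)))
        t' c' (inj₂ (inj₁ t'→y)) →
          ⊥-elim (a≢chosen (trans (cong g (trans (step-toℕ y→t) (cong suc (step-toℕ t'→y)))) c'))
        t' c' (inj₂ (inj₂ y→t')) → toℕ-injective (trans (step-toℕ y→t') (sym (step-toℕ y→t)))
  private-neighbour t c | inj₂ (inj₂ (d≡skipped , e≢chosen)) with successor t (skipped≢outside d≡skipped)
  ...   | y , t→y = y , λ where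
        t' c' (inj₁ refl) →
          ⊥-elim (chosen≢skipped (trans (sym c') (trans (sym (right-cell t→y)) d≡skipped)))
        t' c' (inj₂ (inj₁ t'→y)) →
          toℕ-injective (ℕ.suc-injective (trans (sym (step-toℕ t'→y)) (step-toℕ t→y)))
        t' c' (inj₂ (inj₂ y→t')) →
          ⊥-elim (e≢chosen (trans (cong (λ k → g (2 + k))
            (sym (trans (step-toℕ y→t') (cong suc (step-toℕ t→y))))) c'))

data SplitAt (k : ℕ) : ℕ → Set where
  below : (i : Fin k) → SplitAt k (toℕ i)
  above : ∀ p → SplitAt k (k + p)

splitAt : ∀ k p → SplitAt k p
splitAt zero    p       = above p
splitAt (suc k) zero    = below fzero
splitAt (suc k) (suc p) with splitAt k p
... | below i = below (fsuc i)
... | above q = above q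

PairOffset : Fin 6 → ℕ → Set
PairOffset v s = s ≡ proj₁ (pairOff v) ⊎ s ≡ proj₂ (pairOff v)

pairOffset? : ∀ v s → Dec (PairOffset v s)
pairOffset? v s = s ℕ.≟ proj₁ (pairOff v) ⊎-dec s ℕ.≟ proj₂ (pairOff v)

blockCell : Fin 6 → ℕ → Cell
blockCell v s = if does (pairOffset? v s) then skipped else chosen

-- Chosen by hand so that the windows at both ends of every path pass (see cell-window).
prefix suffix : Fin 6 → Vec Bool 3
prefix = lookup ( (true  ∷ false ∷ false ∷ [])
                ∷ (false ∷ true  ∷ false ∷ [])
                ∷ (true  ∷ false ∷ true  ∷ [])
                ∷ (false ∷ true  ∷ false ∷ [])
                ∷ (false ∷ true  ∷ false ∷ [])
                ∷ (true  ∷ false ∷ true  ∷ []) ∷ [])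
suffix = lookup ( (true  ∷ false ∷ true  ∷ [])
                ∷ (false ∷ true  ∷ false ∷ [])
                ∷ (false ∷ false ∷ true  ∷ [])
                ∷ (false ∷ true  ∷ false ∷ [])
                ∷ (true  ∷ false ∷ true  ∷ [])
                ∷ (false ∷ true  ∷ false ∷ []) ∷ [])

middle : Fin 6 → ℕ → ℕ → Cell
middle v zero    0 = mark (lookup (suffix v) 0F)
middle v zero    1 = mark (lookup (suffix v) 1F)
middle v zero    2 = mark (lookup (suffix v) 2F)
middle v zero    (suc (suc (suc s))) = outside
middle v (suc M) 0 = blockCell v 0
middle v (suc M) 1 = blockCell v 1
middle v (suc M) 2 = blockCell v 2
middle v (suc M) 3 = blockCell v 3
middle v (suc M) (suc (suc (suc (suc s)))) = middle v M s

-- The path P_i for x_i = v and M gadgets, padded by two outside cells in front: u_{i,k} is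
-- cell 5 + k, so prefix covers u_{i,-3..-1}, gadget j sees block j of middle, and suffix
-- covers u_{i,4M..4M+2}.
cell : Fin 6 → ℕ → ℕ → Cell
cell v M 0 = outside
cell v M 1 = outside
cell v M 2 = mark (lookup (prefix v) 0F)
cell v M 3 = mark (lookup (prefix v) 1F)
cell v M 4 = mark (lookup (prefix v) 2F)
cell v M (suc (suc (suc (suc (suc s))))) = middle v M s

pathCells : Fin 6 → ℕ → ∀ {N} → Fin N → Cell
pathCells v M t = cell v M (2 + toℕ t)

first-windows? : ∀ M → Dec (∀ v (i : Fin 9) → Window (cell v M) (toℕ i))
first-windows? M = all? λ (v : Fin 6) → all? λ (i : Fin 9) → window? (cell v M) (toℕ i)

-- Shifting by one gadget, cell v (1 + M) (9 + p) = cell v M (5 + p); so only the first nine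
-- windows, for M = 0, 1 and M ≥ 2 (where they no longer depend on M), need checking.
cell-window : ∀ v M p → Window (cell v M) p
cell-window v M p with splitAt 9 p
cell-window v 0             .(toℕ i) | below i = from-yes (first-windows? 0) v i
cell-window v 1             .(toℕ i) | below i = from-yes (first-windows? 1) v i
cell-window v (suc (suc M)) .(toℕ i) | below i = from-yes (first-windows? (2 + M)) v i
cell-window v zero          .(9 + p) | above p = inj₁ (λ ()) , λ ()
cell-window v (suc M)       .(9 + p) | above p = cell-window v M (5 + p)

size-suc : ∀ M → 6 + 4 * suc M ≡ 4 + (6 + 4 * M)
size-suc M = cong (6 +_) (ℕ.*-suc 4 M)

cell-real : ∀ v M k → k < 6 + 4 * M → cell v M (2 + k) ≢ outside
cell-real v zero k k<6 with splitAt 6 k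
... | below i = from-yes (all? λ (v : Fin 6) → all? λ (i : Fin 6) →
                  ¬? (cell v 0 (2 + toℕ i) ≟ outside)) v i
... | above p = ⊥-elim (ℕ.m+n≮m 6 p k<6)
cell-real v (suc M) k k< with splitAt 7 k
... | below i = from-yes (all? λ (v : Fin 6) → all? λ (i : Fin 7) →
                  ¬? (cell v (suc M) (2 + toℕ i) ≟ outside)) v i
... | above p = cell-real v M (3 + p) (ℕ.+-cancelˡ-< 4 _ _ (subst (7 + p <_) (size-suc M) k<))

cell-outside : ∀ v M k → 6 + 4 * M ≤ k → cell v M (2 + k) ≡ outside
cell-outside v zero k 6≤k with splitAt 6 k
... | below i = ⊥-elim (ℕ.<⇒≱ (Fin.toℕ<n i) 6≤k)
... | above p = refl
cell-outside v (suc M) k ≤k with splitAt 7 k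
... | below i = ⊥-elim (ℕ.<⇒≱ (Fin.toℕ<n i)
                  (ℕ.≤-trans (subst (7 ≤_) (sym (size-suc M)) (ℕ.m≤m+n 7 _)) ≤k))
... | above p = cell-outside v M (3 + p) (ℕ.+-cancelˡ-≤ 4 _ _ (subst (_≤ 7 + p) (size-suc M) ≤k))

blockCell-pair : ∀ v {s} → PairOffset v s → blockCell v s ≡ skipped
blockCell-pair v {s} po = cong (if_then skipped else chosen) (dec-true (pairOffset? v s) po)

pairOff-<4 : ∀ v → proj₁ (pairOff v) < 4 × proj₂ (pairOff v) < 4
pairOff-<4 = from-yes (all? λ (v : Fin 6) → proj₁ (pairOff v) <? 4 ×-dec proj₂ (pairOff v) <? 4)

pairOffset-<4 : ∀ v {s} → PairOffset v s → s < 4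
pairOffset-<4 v (inj₁ refl) = proj₁ (pairOff-<4 v)
pairOffset-<4 v (inj₂ refl) = proj₂ (pairOff-<4 v)

middle-block : ∀ v M j s → j < M → s < 4 → middle v M (4 * j + s) ≡ blockCell v s
middle-block v (suc M) zero 0 _ _ = refl
middle-block v (suc M) zero 1 _ _ = refl
middle-block v (suc M) zero 2 _ _ = refl
middle-block v (suc M) zero 3 _ _ = refl
middle-block v (suc M) zero (suc (suc (suc (suc s)))) _ (s≤s (s≤s (s≤s (s≤s ()))))
middle-block v (suc M) (suc j) s (s≤s j<M) s<4 =
  trans (cong (middle v (suc M)) (trans (cong (_+ s) (ℕ.*-suc 4 j)) (ℕ.+-assoc 4 (4 * j) s)))
        (middle-block v M j s j<M s<4)

cell-pair : ∀ v M j s → j < M → PairOffset v s → cell v M (2 + (4 * j + s + 3)) ≡ skipped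
cell-pair v M j s j<M po = begin
  cell v M (2 + (4 * j + s + 3)) ≡⟨ cong (λ k → cell v M (2 + k)) (ℕ.+-comm (4 * j + s) 3) ⟩
  middle v M (4 * j + s)         ≡⟨ middle-block v M j s j<M (pairOffset-<4 v po) ⟩
  blockCell v s                  ≡⟨ blockCell-pair v po ⟩
  skipped                        ∎
  where open ≡-Reasoning

indicator : Cell → ℕ
indicator chosen = 1
indicator _      = 0

count : ∀ N → (Fin N → Cell) → ℕ
count zero    f = 0
count (suc N) f = indicator (f fzero) + count N (f ∘ fsuc)

length-filter-tabulate : ∀ {N} {X : Set} (h : Fin N → X) (c : X → Cell) →
  length (filter (λ x → c x ≟ chosen) (tabulate h)) ≡ count N (c ∘ h)
length-filter-tabulate {zero}  h c = refl
length-filter-tabulate {suc N} h c with c (h fzero) | length-filter-tabulate (h ∘ fsuc) c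
... | chosen  | ih = cong suc ih
... | skipped | ih = ih
... | outside | ih = ih

block-count : ∀ v r → indicator (blockCell v 0) + (indicator (blockCell v 1) +
  (indicator (blockCell v 2) + (indicator (blockCell v 3) + r))) ≡ 2 + r
block-count 0F r = refl
block-count 1F r = refl
block-count 2F r = refl
block-count 3F r = refl
block-count 4F r = refl
block-count 5F r = refl

count-suc : ∀ v M → count (6 + 4 * suc M) (pathCells v (suc M)) ≡ 2 + count (6 + 4 * M) (pathCells v M)
count-suc v M =
  subst (λ N → count N (pathCells v (suc M)) ≡ 2 + count (6 + 4 * M) (pathCells v M)) (sym (size-suc M))
    (trans (cong (λ r → a + (b + (c + r))) (block-count v rest)) (move-2 a b c rest))
  where
  a = indicator (cell v M 2)
  b = indicator (cell v M 3)
  c = indicator (cell v M 4)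
  rest = count (3 + 4 * M) (λ t → middle v M (toℕ t))
  move-2 : ∀ a b c r → a + (b + (c + (2 + r))) ≡ 2 + (a + (b + (c + r)))
  move-2 = solve-∀

count-pathCells : ∀ v M → 2 + 2 * M ≤ count (6 + 4 * M) (pathCells v M)
count-pathCells v zero = from-yes (all? λ (v : Fin 6) → 2 ≤? count 6 (pathCells v 0)) v
count-pathCells v (suc M) rewrite count-suc v M | ℕ.*-suc 2 M = s≤s (s≤s (count-pathCells v M))

module Witness {q : ℕ} (φ : CSP6 q) (sat : Satisfiable φ) where
  open Construction φ

  M : ℕ
  M = F * m

  x : Fin n → Fin 6
  x = proj₁ sat

  sel : (j : Fin M) → Fin (C (red j))
  sel j = proj₁ (proj₂ sat (red j))

  sel-agrees : ∀ j p → σ (red j) (sel j) p ≡ x (scope (red j) p)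
  sel-agrees j = proj₂ (proj₂ sat (red j))

  InD : Vertex → Set
  InD (u i t)    = pathCells (x i) M t ≡ chosen
  InD (kv _ _ _) = ⊥
  InD (lv j l _) = l ≡ sel j
  InD (w _)      = ⊥

  chosenOn? : (i : Fin n) (t : Fin (6 + 4 * M)) → Dec (InD (u i t))
  chosenOn? i t = pathCells (x i) M t ≟ chosen

  pathPart : Fin n → List Vertex
  pathPart i = map (u i) (filter (chosenOn? i) (allFin (6 + 4 * M)))

  gadgetPart : Fin M → List Vertex
  gadgetPart j = map (lv j (sel j)) (allFin A)

  D : List Vertex
  D = ⋃ pathPart ++ ⋃ gadgetPart

  ∈D⁺ : ∀ v → InD v → v ∈ D
  ∈D⁺ (u i t) c = ∈-++⁺ˡ (∈-⋃⁺ pathPart i (∈-map⁺ (u i) (∈-filter⁺ (chosenOn? i) (∈-allFin t) c)))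
  ∈D⁺ (lv j l a) refl = ∈-++⁺ʳ (⋃ pathPart) (∈-⋃⁺ gadgetPart j (∈-map⁺ (lv j l) (∈-allFin a)))

  ∈D⁻ : ∀ v → v ∈ D → InD v
  ∈D⁻ v v∈D with ∈-++⁻ (⋃ pathPart) v∈D
  ... | inj₁ v∈path with ∈-⋃⁻ pathPart v∈path
  ...   | i , v∈ with ∈-map⁻ (u i) v∈
  ...     | t , t∈ , refl = proj₂ (∈-filter⁻ (chosenOn? i) {xs = allFin _} t∈)
  ∈D⁻ v v∈D | inj₂ v∈gadget with ∈-⋃⁻ gadgetPart v∈gadget
  ...   | j , v∈ with ∈-map⁻ (lv j (sel j)) v∈
  ...     | a , _ , refl = refl

  D-unique : Unique D
  D-unique =
    ++⁺ (⋃-unique pathPart (λ i → map⁺ u-injective (filter⁺ (chosenOn? i) (allFin⁺ _))) path-owner)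
        (⋃-unique gadgetPart (λ j → map⁺ lv-injective (allFin⁺ A)) gadget-owner)
        (λ (v∈path , v∈gadget) → path≢gadget (∈-⋃⁻ pathPart v∈path) (∈-⋃⁻ gadgetPart v∈gadget))
    where
    u-injective : ∀ {i t t'} → u i t ≡ u i t' → t ≡ t'
    u-injective refl = refl
    lv-injective : ∀ {j l a a'} → lv j l a ≡ lv j l a' → a ≡ a'
    lv-injective refl = refl
    path-owner : ∀ {i i' v} → v ∈ pathPart i → v ∈ pathPart i' → i ≡ i'
    path-owner {i} {i'} v∈ v∈' with ∈-map⁻ (u i) v∈ | ∈-map⁻ (u i') v∈'
    ... | _ , _ , refl | _ , _ , refl = refl
    gadget-owner : ∀ {j j' v} → v ∈ gadgetPart j → v ∈ gadgetPart j' → j ≡ j'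
    gadget-owner {j} {j'} v∈ v∈' with ∈-map⁻ (lv j (sel j)) v∈ | ∈-map⁻ (lv j' (sel j')) v∈'
    ... | _ , _ , refl | _ , _ , refl = refl
    path≢gadget : ∀ {v} → Σ (Fin n) (λ i → v ∈ pathPart i) → Σ (Fin M) (λ j → v ∈ gadgetPart j) → ⊥
    path≢gadget (i , v∈) (j , v∈') with ∈-map⁻ (u i) v∈ | ∈-map⁻ (lv j (sel j)) v∈'
    ... | _ , _ , refl | _ , _ , ()

  k≤|D| : k ≤ length D
  k≤|D| = begin
    k                                           ≡⟨ size-identity M n A ⟩
    n * (2 + 2 * M) + M * A                     ≤⟨ ℕ.+-mono-≤ (length-⋃ pathPart path-length)
                                                                 (length-⋃ gadgetPart gadget-length) ⟩
    length (⋃ pathPart) + length (⋃ gadgetPart) ≡⟨ length-++ (⋃ pathPart) ⟨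
    length D                                    ∎
    where
    open ℕ.≤-Reasoning
    size-identity : ∀ M n A → M * (2 * n + A) + 2 * n ≡ n * (2 + 2 * M) + M * A
    size-identity = solve-∀
    path-length : ∀ i → 2 + 2 * M ≤ length (pathPart i)
    path-length i = begin
      2 + 2 * M                                ≤⟨ count-pathCells (x i) M ⟩
      count (6 + 4 * M) (pathCells (x i) M)    ≡⟨ length-filter-tabulate id (pathCells (x i) M) ⟨
      length (filter (chosenOn? i) (allFin _)) ≡⟨ length-map (u i) (filter (chosenOn? i) (allFin _)) ⟨
      length (pathPart i)                      ∎
    gadget-length : ∀ j → A ≤ length (gadgetPart j)
    gadget-length j = ℕ.≤-reflexive (sym (trans (length-map _ (allFin A)) (length-tabulate id)))

  module Row (i : Fin n) = PathDomination {5 + 4 * M} (cell (x i) M) (cell-window (x i) M) refl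
                             (cell-real (x i) M) (cell-outside (x i) M)

  step-edge : ∀ {i} {s t : Fin (6 + 4 * M)} → Step s t → Edge (u i s) (u i t)
  step-edge (step t) = path _ t

  someCopy : Fin A
  someCopy = fromℕ< {0} (ℕ.≤-trans (s≤s z≤n) (ℕ.m≤n+m 2 (4 * q)))

  dominating : IsDominating Adj D
  dominating (u i t) with Row.dominated i t
  ... | inj₁ c = inj₁ (∈D⁺ _ c)
  ... | inj₂ (s , c , inj₁ s→t) = inj₂ (u i s , ∈D⁺ _ c , inj₁ (step-edge s→t))
  ... | inj₂ (s , c , inj₂ t→s) = inj₂ (u i s , ∈D⁺ _ c , inj₂ (step-edge t→s))
  dominating (kv j l a) with l Fin.≟ sel j
  ... | yes refl = inj₂ (lv j l a , ∈D⁺ _ refl , inj₂ (match j l a))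
  ... | no l≢sel = inj₂ (lv j (sel j) a , ∈D⁺ _ refl , inj₂ (cross j l a (sel j) a l≢sel))
  dominating (lv j l a) with l Fin.≟ sel j
  ... | yes l≡sel = inj₁ (∈D⁺ _ l≡sel)
  ... | no l≢sel = inj₂ (lv j (sel j) a , ∈D⁺ _ refl , inj₁ (ll j (sel j) a l a λ (e , _) → l≢sel (sym e)))
  dominating (w j) = inj₂ (lv j (sel j) someCopy , ∈D⁺ _ refl , inj₁ (lw j (sel j) someCopy))

  pair-skipped : ∀ {v t} j → InPair v t j → pathCells v M t ≡ skipped
  pair-skipped {v} j (inj₁ e) =
    subst (λ k → cell v M (2 + k) ≡ skipped) (sym e) (cell-pair v M (toℕ j) _ (Fin.toℕ<n j) (inj₁ refl))
  pair-skipped {v} j (inj₂ e) =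
    subst (λ k → cell v M (2 + k) ≡ skipped) (sym e) (cell-pair v M (toℕ j) _ (Fin.toℕ<n j) (inj₂ refl))

  u-neighbour : ∀ {z i y} → Adj z (u i y) → InD z →
    Σ (Fin (6 + 4 * M)) λ t → z ≡ u i t × (Step t y ⊎ Step y t)
  u-neighbour (inj₁ (path _ t)) _ = inject₁ t , refl , inj₁ (step t)
  u-neighbour (inj₂ (path _ t)) _ = fsuc t , refl , inj₂ (step t)
  u-neighbour (inj₁ (ku _ _ _ _ _ _)) ()

  kv-private : ∀ {j l a} → l ≡ sel j → ∀ z → InD z → z ≡ kv j l a ⊎ Adj z (kv j l a) → z ≡ lv j l a
  kv-private _ _ () (inj₁ refl)
  kv-private _ _ () (inj₂ (inj₁ (kk _ _ _ _ _ _)))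
  kv-private _ _ () (inj₂ (inj₂ (kk _ _ _ _ _ _)))
  kv-private refl _ c (inj₂ (inj₂ (ku j _ _ p t in-pair))) =
    ⊥-elim (chosen≢skipped (trans (sym c)
      (pair-skipped j (subst (λ v → InPair v t j) (sel-agrees j p) in-pair))))
  kv-private _ _ _ (inj₂ (inj₂ (match _ _ _))) = refl
  kv-private refl _ refl (inj₂ (inj₂ (cross _ _ _ _ _ l≢l'))) = ⊥-elim (l≢l' refl)

  private-neighbour : ∀ v → v ∈ D → Σ Vertex (PrivateNeighbour Adj D v)
  private-neighbour v v∈D = neighbour v (∈D⁻ v v∈D)
    where
    neighbour : ∀ v → InD v → Σ Vertex (PrivateNeighbour Adj D v)
    neighbour (u i t) c with Row.private-neighbour i t c
    ... | y , private-y = u i y , λ where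
          z z∈D (inj₁ refl) → cong (u i) (private-y y (∈D⁻ _ z∈D) (inj₁ refl))
          z z∈D (inj₂ z~y) → case u-neighbour z~y (∈D⁻ z z∈D) of λ where
            (t' , refl , st) → cong (u i) (private-y t' (∈D⁻ _ z∈D) (inj₂ st))
    neighbour (lv j l a) l≡sel = kv j l a , λ z z∈D → kv-private l≡sel z (∈D⁻ z z∈D)

lemma4 : ∀ {q : ℕ} (φ : CSP6 q) → Satisfiable φ →
    Σ (List (Construction.Vertex φ)) λ D →
      IsUpperDominating (Construction.Adj φ) D × Unique D × Construction.k φ ≤ length D
lemma4 φ sat = D , private-neighbours⇒upper-dominating Adj dominating private-neighbour , D-unique , k≤|D|
  where
  open Construction φ
  open Witness φ sat
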